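{- Let $D_C$ be the ordered graph on vertex set $\{1,2,3,4\}$ whose edges are all pairs except $\{1,3\}$ (an ordering of the diamond $K_4-e$). Then $r_<(D_C)\le 14$.
   Context: An ordered graph on $n$ vertices is a graph with vertex set $[n]=\{1,\dots,n\}$ equipped with the natural order. Given an ordered graph $H$ on $[n]$ and a red/blue coloring of the edges of the complete graph $K_N$ on vertex set $[N]$, a monochromatic ordered copy of $H$ is a strictly increasing map $\phi:[n]\to[N]$ such that all edges $\{\phi(i),\phi(j)\}$ with $\{i,j\}\in E(H)$ receive the same color. The ordered Ramsey number $r_<(H)$ is the least $N$ such that every red/blue coloring of the edges of the complete graph on $[N]$ contains a monochromatic ordered copy of $H$. -}

module Defs where

open import Data.Nat using (ℕ; _≤_)
open import Data.Fin using (Fin; zero; suc; _<_)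
open import Data.Bool using (Bool; true; false)
open import Data.Product using (Σ; ∃; _×_)
open import Relation.Binary.PropositionalEquality using (_≡_)

-- An ordered graph on [n] (vertices Fin n, ordered naturally).
-- The adjacency predicate is only consulted on pairs i < j, i.e. it
-- describes the edge {i,j} with i < j.
record OrderedGraph (n : ℕ) : Set where
  field
    adj : Fin n → Fin n → Bool

-- A red/blue colouring of the edges of K_N on [N]: the colour of the
-- edge {u,v} with u < v is  col u v  (true = red, false = blue).
Colouring : ℕ → Set
Colouring N = Fin N → Fin N → Bool

StrictlyIncreasing : ∀ {n N} → (Fin n → Fin N) → Set
StrictlyIncreasing {n} φ = ∀ (i j : Fin n) → i < j → φ i < φ j

MonoOrderedCopy : ∀ {n N} → OrderedGraph n → Colouring N → Set
MonoOrderedCopy {n} {N} H c =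
  Σ (Fin n → Fin N) λ φ → StrictlyIncreasing φ ×
    Σ Bool λ colour →
      ∀ (i j : Fin n) → i < j → OrderedGraph.adj H i j ≡ true →
        c (φ i) (φ j) ≡ colour

Arrows : ∀ {n} → ℕ → OrderedGraph n → Set
Arrows N H = (c : Colouring N) → MonoOrderedCopy H c

-- r_<(H) ≤ M  :  the least N with  Arrows N H  is at most M, i.e. some N ≤ M works.
OrdRamseyAtMost : ∀ {n} → OrderedGraph n → ℕ → Set
OrdRamseyAtMost H M = Σ ℕ λ N → N ≤ M × Arrows N H

-- D_C : vertices 1,2,3,4 (Fin 4: 0,1,2,3), all pairs except {1,3} (= {0,2}).
D-C : OrderedGraph 4
D-C = record { adj = a }
  where
  a : Fin 4 → Fin 4 → Bool
  a zero (suc (suc zero)) = false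
  a (suc (suc zero)) zero = false
  a _ _ = true

-- Fix the last vertex n as an apex and give every earlier vertex i its apex colour
-- χ(i,n) together with one bit: whether some u < i has χ(u,n) = χ(u,i) = χ(i,n).
-- Among 13 vertices below the apex one of these four classes has four members
-- i₁ < i₂ < i₃ < i₄. If the class is witnessed, an edge of the apex colour between
-- two members i < j closes the diamond u < i < j < n; if it is not, such an edge
-- would make i a witness for j. So the four members span a K₄ in the other colour.
module Submission where

open import Data.Bool using (Bool; true; false; not; if_then_else_)
open import Data.Bool.Properties using (_≟_; ¬-not)
open import Data.Fin using (Fin; zero; suc; toℕ; fromℕ<) renaming (_<_ to _<ᶠ_)
open import Data.Fin.Properties using (toℕ-fromℕ<)
open import Data.Nat using (ℕ; zero; suc; _+_; _≤_; _<_; _≤?_; _<?_; s≤s; s≤s⁻¹)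
open import Data.Nat.Properties
  using (≤-refl; <-trans; ≤-<-trans; <⇒≤; +-suc; +-mono-≤; <⇒≱; ≰⇒>; m≤n⇒m≤1+n; n<1+n; anyUpTo?)
open import Data.Product using (∃; _×_; _,_)
open import Data.Sum using (_⊎_; inj₁; inj₂; [_,_]′)
open import Level using (Level; 0ℓ)
open import Relation.Binary.PropositionalEquality using (_≡_; refl; sym; trans; cong; subst; subst₂)
open import Relation.Nullary using (does; yes; no; contradiction; _×-dec_)
open import Relation.Unary using (Pred; Decidable; _∩_; ∁)
open import Relation.Unary.Properties using (_∩?_; ∁?)

open import Defs

private
  variable
    ℓ ℓ′ : Level
    P : Pred ℕ ℓ
    Q : Pred ℕ ℓ′

count : Decidable P → ℕ → ℕ
count P? zero    = zero
count P? (suc n) = if does (P? n) then suc (count P? n) else count P? n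

count-∩-∁ : (P? : Decidable P) (Q? : Decidable Q) →
            ∀ n → count P? n ≡ count (P? ∩? Q?) n + count (P? ∩? ∁? Q?) n
count-∩-∁ P? Q? zero = refl
count-∩-∁ P? Q? (suc n) with P? n | Q? n
... | yes _ | yes _ = cong suc (count-∩-∁ P? Q? n)
... | yes _ | no _  = trans (cong suc (count-∩-∁ P? Q? n)) (sym (+-suc _ _))
... | no _  | _     = count-∩-∁ P? Q? n

count-fibres : (f : ℕ → Bool) →
               ∀ n → count (λ i → f i ≟ true) n + count (λ i → f i ≟ false) n ≡ n
count-fibres f zero = refl
count-fibres f (suc n) with f n
... | true  = cong suc (count-fibres f n)
... | false = trans (+-suc _ _) (cong suc (count-fibres f n))

count-witness : (P? : Decidable P) → ∀ {m} n → suc m ≤ count P? n →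
                ∃ λ i → i < n × P i × m ≤ count P? i
count-witness P? (suc n) m<count with P? n
... | yes Pn = n , ≤-refl , Pn , s≤s⁻¹ m<count
... | no _ with count-witness P? n m<count
...   | i , i<n , Pi , m≤count = i , m≤n⇒m≤1+n i<n , Pi , m≤count

pigeonhole₂ : ∀ {m a b} → suc (m + m) ≤ a + b → suc m ≤ a ⊎ suc m ≤ b
pigeonhole₂ {m} {a} {b} 2m<a+b with suc m ≤? a | suc m ≤? b
... | yes m<a | _       = inj₁ m<a
... | no _    | yes m<b = inj₂ m<b
... | no m≮a  | no m≮b  =
  contradiction (+-mono-≤ (s≤s⁻¹ (≰⇒> m≮a)) (s≤s⁻¹ (≰⇒> m≮b))) (<⇒≱ 2m<a+b)

record Diamond (χ : ℕ → ℕ → Bool) (n : ℕ) : Set where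
  constructor diamond
  field
    a b c d : ℕ
    a<b     : a < b
    b<c     : b < c
    c<d     : c < d
    d≤n     : d ≤ n
    colour  : Bool
    χab     : χ a b ≡ colour
    χad     : χ a d ≡ colour
    χbc     : χ b c ≡ colour
    χbd     : χ b d ≡ colour
    χcd     : χ c d ≡ colour

module _ {χ : ℕ → ℕ → Bool} {n : ℕ} where

  K₄⇒diamond : (Cls : Pred ℕ ℓ) (K : Bool) →
               (∀ {i j} → Cls i → Cls j → i < j → j < n → χ i j ≡ K → Diamond χ n) →
               ∀ {a b c d} → a < b → b < c → c < d → d < n →
               Cls a → Cls b → Cls c → Cls d → Diamond χ n
  K₄⇒diamond Cls K edge⇒diamond {a} {b} {c} {d} a<b b<c c<d d<n Ca Cb Cc Cd =
    otherColour Ca Cb a<b b<n λ χab →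
    otherColour Ca Cd a<d d<n λ χad →
    otherColour Cb Cc b<c c<n λ χbc →
    otherColour Cb Cd b<d d<n λ χbd →
    otherColour Cc Cd c<d d<n λ χcd →
    diamond _ _ _ _ a<b b<c c<d (<⇒≤ d<n) (not K) χab χad χbc χbd χcd
    where
    c<n : c < n
    c<n = <-trans c<d d<n
    b<n : b < n
    b<n = <-trans b<c c<n
    b<d : b < d
    b<d = <-trans b<c c<d
    a<d : a < d
    a<d = <-trans a<b b<d

    otherColour : ∀ {i j} → Cls i → Cls j → i < j → j < n →
                  (χ i j ≡ not K → Diamond χ n) → Diamond χ n
    otherColour {i} {j} Ci Cj i<j j<n k with χ i j ≟ K
    ... | yes χij≡K = edge⇒diamond Ci Cj i<j j<n χij≡K
    ... | no  χij≢K = k (¬-not χij≢K)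

  largeClass⇒diamond : {Cls : Pred ℕ ℓ} (Cls? : Decidable Cls) (K : Bool) → 4 ≤ count Cls? n →
                       (∀ {i j} → Cls i → Cls j → i < j → j < n → χ i j ≡ K → Diamond χ n) →
                       Diamond χ n
  largeClass⇒diamond {Cls = Cls} Cls? K 4≤count edge⇒diamond
    with count-witness Cls? n 4≤count
  ... | d , d<n , Pd , 3≤count with count-witness Cls? d 3≤count
  ... | c , c<d , Pc , 2≤count with count-witness Cls? c 2≤count
  ... | b , b<c , Pb , 1≤count with count-witness Cls? b 1≤count
  ... | a , a<b , Pa , _ =
    K₄⇒diamond Cls K edge⇒diamond a<b b<c c<d d<n Pa Pb Pc Pd

module Apex (χ : ℕ → ℕ → Bool) (n : ℕ) where

  ApexColour : Bool → Pred ℕ 0ℓ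
  ApexColour K i = χ i n ≡ K

  apexColour? : ∀ K → Decidable (ApexColour K)
  apexColour? K i = χ i n ≟ K

  Witnessed : Pred ℕ 0ℓ
  Witnessed i = ∃ λ u → u < i × χ u n ≡ χ i n × χ u i ≡ χ i n

  witnessed? : Decidable Witnessed
  witnessed? i = anyUpTo? (λ u → (χ u n ≟ χ i n) ×-dec (χ u i ≟ χ i n)) i

  Class : Bool → Bool → Pred ℕ 0ℓ
  Class K true  = ApexColour K ∩ Witnessed
  Class K false = ApexColour K ∩ ∁ Witnessed

  class? : ∀ K S → Decidable (Class K S)
  class? K true  = apexColour? K ∩? witnessed?
  class? K false = apexColour? K ∩? ∁? witnessed?

  class-edge⇒diamond : ∀ K S {i j} → Class K S i → Class K S j → i < j → j < n →
                       χ i j ≡ K → Diamond χ n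
  class-edge⇒diamond K true (χin , u , u<i , χun , χui) (χjn , _) i<j j<n χij =
    diamond u _ _ n u<i i<j j<n ≤-refl K (trans χui χin) (trans χun χin) χij χin χjn
  class-edge⇒diamond K false (χin , _) (χjn , ¬wj) i<j _ χij =
    contradiction (_ , i<j , trans χin (sym χjn) , trans χij (sym χjn)) ¬wj

  diamond-below-apex : 13 ≤ n → Diamond χ n
  diamond-below-apex 13≤n =
    [ inColour true , inColour false ]′
      (pigeonhole₂ (subst (13 ≤_) (sym (count-fibres (λ i → χ i n) n)) 13≤n))
    where
    inClass : ∀ K S → 4 ≤ count (class? K S) n → Diamond χ n
    inClass K S 4≤count = largeClass⇒diamond (class? K S) K 4≤count (class-edge⇒diamond K S)

    inColour : ∀ K → 7 ≤ count (apexColour? K) n → Diamond χ n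
    inColour K 7≤count =
      [ inClass K true , inClass K false ]′
        (pigeonhole₂ (subst (7 ≤_) (count-∩-∁ (apexColour? K) witnessed? n) 7≤count))

extend : ∀ {N} → Colouring N → ℕ → ℕ → Bool
extend {N} c i j with i <? N | j <? N
... | yes i<N | yes j<N = c (fromℕ< i<N) (fromℕ< j<N)
... | _       | _       = false   -- vertices outside [N] never occur in a copy

extend-fromℕ< : ∀ {N} (c : Colouring N) {i j} (i<N : i < N) (j<N : j < N) →
                extend c i j ≡ c (fromℕ< i<N) (fromℕ< j<N)
extend-fromℕ< {N} c {i} {j} i<N j<N with i <? N | j <? N
... | yes _ | yes _  = refl   -- the proof argument of fromℕ< is irrelevant
... | no i≮N | _     = contradiction i<N i≮N
... | yes _ | no j≮N = contradiction j<N j≮N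

copy-from-ℕ : ∀ {k N} (H : OrderedGraph k) (c : Colouring N) (v : Fin k → ℕ) (K : Bool) →
              (v<N : ∀ i → v i < N) →
              (∀ i j → i <ᶠ j →
                 v i < v j × (OrderedGraph.adj H i j ≡ true → extend c (v i) (v j) ≡ K)) →
              MonoOrderedCopy H c
copy-from-ℕ H c v K v<N v-pairs = φ , φ-increasing , K , φ-edges
  where
  φ : Fin _ → Fin _
  φ i = fromℕ< (v<N i)

  φ-increasing : StrictlyIncreasing φ
  φ-increasing i j i<j with v-pairs i j i<j
  ... | vi<vj , _ = subst₂ _<_ (sym (toℕ-fromℕ< (v<N i))) (sym (toℕ-fromℕ< (v<N j))) vi<vj

  φ-edges : ∀ i j → i <ᶠ j → OrderedGraph.adj H i j ≡ true → c (φ i) (φ j) ≡ K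
  φ-edges i j i<j ij with v-pairs i j i<j
  ... | _ , v-edge = trans (sym (extend-fromℕ< c (v<N i) (v<N j))) (v-edge ij)

diamond⇒copy : ∀ {N n} (c : Colouring N) → Diamond (extend c) n → n < N → MonoOrderedCopy D-C c
diamond⇒copy {N} c (diamond a b c′ d a<b b<c c<d d≤n K χab χad χbc χbd χcd) n<N =
  copy-from-ℕ D-C c v K v<N v-pairs
  where
  v : Fin 4 → ℕ
  v zero                   = a
  v (suc zero)             = b
  v (suc (suc zero))       = c′
  v (suc (suc (suc zero))) = d

  d<N : d < N
  d<N = ≤-<-trans d≤n n<N

  v<N : ∀ i → v i < N
  v<N zero                   = <-trans (<-trans a<b (<-trans b<c c<d)) d<N
  v<N (suc zero)             = <-trans (<-trans b<c c<d) d<N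
  v<N (suc (suc zero))       = <-trans c<d d<N
  v<N (suc (suc (suc zero))) = d<N

  v-pairs : ∀ i j → i <ᶠ j →
            v i < v j × (OrderedGraph.adj D-C i j ≡ true → extend c (v i) (v j) ≡ K)
  v-pairs zero                   (suc zero)               _ = a<b , λ _ → χab
  v-pairs zero                   (suc (suc zero))         _ = <-trans a<b b<c , λ ()
  v-pairs zero                   (suc (suc (suc zero)))   _ = <-trans a<b (<-trans b<c c<d) , λ _ → χad
  v-pairs (suc zero)             (suc (suc zero))         _ = b<c , λ _ → χbc
  v-pairs (suc zero)             (suc (suc (suc zero)))   _ = <-trans b<c c<d , λ _ → χbd
  v-pairs (suc (suc zero))       (suc (suc (suc zero)))   _ = c<d , λ _ → χcd
  v-pairs _                      zero                     ()
  v-pairs (suc zero)             (suc zero)               (s≤s ())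
  v-pairs (suc (suc _))          (suc zero)               (s≤s ())
  v-pairs (suc (suc zero))       (suc (suc zero))         (s≤s (s≤s ()))
  v-pairs (suc (suc (suc _)))    (suc (suc zero))         (s≤s (s≤s ()))
  v-pairs (suc (suc (suc zero))) (suc (suc (suc zero)))   (s≤s (s≤s (s≤s ())))

D-C-arrows : ∀ {n} → 13 ≤ n → Arrows (suc n) D-C
D-C-arrows {n} 13≤n c = diamond⇒copy c (Apex.diamond-below-apex (extend c) n 13≤n) (n<1+n n)

theorem3p5 : OrdRamseyAtMost D-C 14
theorem3p5 = 14 , ≤-refl , D-C-arrows ≤-refl
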